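{- Let $v\ge 2$ be an integer and let $q$ be a prime power with $q\ge 2v+1$ and $(v,q)\notin\{(2,5),(2,7)\}$. Then $$\left\lfloor \frac{qv}{v+1}\right\rfloor^{v} > \frac{q^{v}}{v+1}.$$
   Context: $\lfloor x\rfloor$ denotes the greatest integer less than or equal to $x$. -}

module Defs where

open import Data.Nat using (ℕ; _^_; _≤_)
open import Data.Nat.Primality using (Prime)
open import Data.Product using (Σ; ∃; _×_)
open import Relation.Binary.PropositionalEquality using (_≡_)

IsPrimePower : ℕ → Set
IsPrimePower q = Σ ℕ λ p → Σ ℕ λ k → Prime p × 1 ≤ k × q ≡ p ^ k

-- Write q = n + 1. Since ⌊qv/(v+1)⌋ ≥ vn/(v+1), it suffices that
-- ((n+1)(v+1)/(vn))^v < v + 1 (ScaledBound v n). The left side decreases in n,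
-- so only n = 2v matters (n = 7 when v = 2). There (1 + 1/v)(1 + 1/2v) ≤ (1 + 1/2v)³,
-- and the reverse Bernoulli bound (1 + a/M)^k ≤ M/(M − ka) gives (1 + 1/2v)^v ≤ 2,
-- so the left side is at most 8 < v + 1 once v ≥ 8; smaller v are checked by computation.
module Submission where

open import Defs
open import Data.Nat using (ℕ; suc; _+_; _*_; _^_; _≤_; _<_)
open import Data.Nat.DivMod using (_/_)
open import Data.Product using (_×_)
open import Relation.Nullary using (¬_)
open import Relation.Binary.PropositionalEquality using (_≡_)

open import Data.Nat using (zero; z≤n; s≤s; z<s; s≤s⁻¹; NonZero; >-nonZero; _%_; _<?_)
open import Data.Nat.Properties
open import Data.Nat.DivMod using (m≡m%n+[m/n]*n; m%n<n)
open import Data.Nat.Solver using (module +-*-Solver)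
open import Data.Product using (_,_)
open import Data.Unit using (tt)
open import Data.Empty using (⊥-elim)
open import Relation.Nullary using (Dec)
open import Relation.Nullary.Decidable using (toWitness)
open import Relation.Binary.PropositionalEquality
  using (refl; sym; trans; cong; subst; module ≡-Reasoning)
open +-*-Solver

^-distribʳ-* : ∀ m n o → (m * n) ^ o ≡ m ^ o * n ^ o
^-distribʳ-* m n zero = refl
^-distribʳ-* m n (suc o) = begin
  m * n * (m * n) ^ o        ≡⟨ cong (m * n *_) (^-distribʳ-* m n o) ⟩
  m * n * (m ^ o * n ^ o)    ≡⟨ solve 4 (λ m n x y → m :* n :* (x :* y) := m :* x :* (n :* y)) refl m n (m ^ o) (n ^ o) ⟩
  m * m ^ o * (n * n ^ o)    ∎
  where open ≡-Reasoning

^-comm : ∀ m n o → (m ^ n) ^ o ≡ (m ^ o) ^ n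
^-comm m n o = trans (^-*-assoc m n o) (trans (cong (m ^_) (*-comm n o)) (sym (^-*-assoc m o n)))

ratio-^-<-mono : ∀ {a a₀ b b₀} v c .{{_ : NonZero b}} →
  a * b₀ ≤ a₀ * b → a₀ ^ v < c * b₀ ^ v → a ^ v < c * b ^ v
ratio-^-<-mono {a} {a₀} {b} {b₀} v c ab₀≤a₀b a₀^v<cb₀^v = *-cancelʳ-< (b₀ ^ v) _ _ (begin-strict
  a ^ v * b₀ ^ v         ≡⟨ sym (^-distribʳ-* a b₀ v) ⟩
  (a * b₀) ^ v           ≤⟨ ^-monoˡ-≤ v ab₀≤a₀b ⟩
  (a₀ * b) ^ v           ≡⟨ ^-distribʳ-* a₀ b v ⟩
  a₀ ^ v * b ^ v         <⟨ *-monoˡ-< (b ^ v) {{m^n≢0 b v}} a₀^v<cb₀^v ⟩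
  c * b₀ ^ v * b ^ v     ≡⟨ solve 3 (λ c x y → c :* x :* y := c :* y :* x) refl c (b₀ ^ v) (b ^ v) ⟩
  c * b ^ v * b₀ ^ v     ∎)
  where open ≤-Reasoning

reverse-bernoulli : ∀ n a d → (a + (n * a + d)) ^ n * d ≤ (n * a + d) ^ suc n
reverse-bernoulli zero a d = ≤-reflexive (trans (+-identityʳ d) (sym (*-identityʳ d)))
reverse-bernoulli (suc n) a d = begin
  (a + M) * X * d      ≡⟨ solve 3 (λ P X d → P :* X :* d := X :* (P :* d)) refl (a + M) X d ⟩
  X * ((a + M) * d)    ≤⟨ *-monoʳ-≤ X step ⟩
  X * (M * (a + d))    ≡⟨ solve 4 (λ X M a d → X :* (M :* (a :+ d)) := M :* (X :* (a :+ d))) refl X M a d ⟩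
  M * (X * (a + d))    ≤⟨ *-monoʳ-≤ M ih ⟩
  M * M ^ suc n        ∎
  where
  open ≤-Reasoning
  M = suc n * a + d
  X = (a + M) ^ n
  M-shift : n * a + (a + d) ≡ M
  M-shift = solve 3 (λ n a d → n :* a :+ (a :+ d) := (con 1 :+ n) :* a :+ d) refl n a d
  ih : X * (a + d) ≤ M ^ suc n
  ih = subst (λ z → (a + z) ^ n * (a + d) ≤ z ^ suc n) M-shift (reverse-bernoulli n a (a + d))
  step : (a + M) * d ≤ M * (a + d)
  step = begin
    (a + M) * d     ≡⟨ solve 3 (λ M a d → (a :+ M) :* d := M :* d :+ a :* d) refl M a d ⟩
    M * d + a * d   ≤⟨ +-monoʳ-≤ (M * d) (*-monoʳ-≤ a (m≤n+m d (suc n * a))) ⟩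
    M * d + a * M   ≡⟨ solve 3 (λ M a d → M :* d :+ a :* M := M :* (a :+ d)) refl M a d ⟩
    M * (a + d)     ∎

[1+2n]^n≤2*[2n]^n : ∀ n → suc (2 * n) ^ n ≤ 2 * (2 * n) ^ n
[1+2n]^n≤2*[2n]^n zero = s≤s z≤n
[1+2n]^n≤2*[2n]^n n@(suc _) = *-cancelʳ-≤ _ _ n (begin
  suc (2 * n) ^ n * n       ≡⟨ cong (λ z → suc z ^ n * n) (sym n*1+n≡2n) ⟩
  suc (n * 1 + n) ^ n * n   ≤⟨ reverse-bernoulli n 1 n ⟩
  (n * 1 + n) ^ suc n       ≡⟨ cong (_^ suc n) n*1+n≡2n ⟩
  2 * n * (2 * n) ^ n       ≡⟨ solve 2 (λ n x → con 2 :* n :* x := con 2 :* x :* n) refl n ((2 * n) ^ n) ⟩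
  2 * (2 * n) ^ n * n       ∎)
  where
  open ≤-Reasoning
  n*1+n≡2n : n * 1 + n ≡ 2 * n
  n*1+n≡2n = solve 1 (λ n → n :* con 1 :+ n := con 2 :* n) refl n

m≤n+[m/1+n]*[1+n] : ∀ m n → m ≤ n + m / suc n * suc n
m≤n+[m/1+n]*[1+n] m n = begin
  m                              ≡⟨ m≡m%n+[m/n]*n m (suc n) ⟩
  m % suc n + m / suc n * suc n  ≤⟨ +-monoˡ-≤ _ (s≤s⁻¹ (m%n<n m (suc n))) ⟩
  n + m / suc n * suc n          ∎
  where open ≤-Reasoning

[1+n]*m≤[1+m]*n : ∀ {m n} → m ≤ n → suc n * m ≤ suc m * n
[1+n]*m≤[1+m]*n {m} {n} m≤n = +-mono-≤ m≤n (≤-reflexive (*-comm n m))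

ScaledBound : ℕ → ℕ → Set
ScaledBound v n = (suc n * suc v) ^ v < suc v * (v * n) ^ v

ScaledBound? : ∀ v n → Dec (ScaledBound v n)
ScaledBound? v n = _ <? _

ScaledBound⇒floor-bound : ∀ v n → ScaledBound v n → suc n ^ v < ((suc n * v) / suc v) ^ v * suc v
ScaledBound⇒floor-bound v n bound = subst (suc n ^ v <_) (*-comm (suc v) (f ^ v))
  (*-cancelʳ-< (S ^ v) _ _ (begin-strict
    suc n ^ v * S ^ v      ≡⟨ sym (^-distribʳ-* (suc n) S v) ⟩
    (suc n * S) ^ v        <⟨ bound ⟩
    S * (v * n) ^ v        ≤⟨ *-monoʳ-≤ S (^-monoˡ-≤ v vn≤fS) ⟩
    S * (f * S) ^ v        ≡⟨ cong (S *_) (^-distribʳ-* f S v) ⟩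
    S * (f ^ v * S ^ v)    ≡⟨ sym (*-assoc S (f ^ v) (S ^ v)) ⟩
    S * f ^ v * S ^ v      ∎))
  where
  open ≤-Reasoning
  S = suc v
  f = (suc n * v) / S
  vn≤fS : v * n ≤ f * S
  vn≤fS = +-cancelˡ-≤ v _ _ (subst (_≤ v + f * S) (cong (v +_) (*-comm n v)) (m≤n+[m/1+n]*[1+n] (suc n * v) v))

ScaledBound-mono : ∀ {v n₀ n} .{{_ : NonZero v}} .{{_ : NonZero n}} →
  n₀ ≤ n → ScaledBound v n₀ → ScaledBound v n
ScaledBound-mono {v} {n₀} {n} n₀≤n = ratio-^-<-mono v (suc v) {{m*n≢0 v n}} (begin
  suc n * suc v * (v * n₀)     ≡⟨ solve 3 (λ v n n₀ → (con 1 :+ n) :* (con 1 :+ v) :* (v :* n₀)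
                                   := (con 1 :+ v) :* v :* ((con 1 :+ n) :* n₀)) refl v n n₀ ⟩
  suc v * v * (suc n * n₀)     ≤⟨ *-monoʳ-≤ (suc v * v) ([1+n]*m≤[1+m]*n n₀≤n) ⟩
  suc v * v * (suc n₀ * n)     ≡⟨ solve 3 (λ v n n₀ → (con 1 :+ v) :* v :* ((con 1 :+ n₀) :* n)
                                   := (con 1 :+ n₀) :* (con 1 :+ v) :* (v :* n)) refl v n n₀ ⟩
  suc n₀ * suc v * (v * n)     ∎)
  where open ≤-Reasoning

ScaledBound-2v-large : ∀ v → 8 ≤ v → ScaledBound v (2 * v)
ScaledBound-2v-large v@(suc _) 8≤v =
  ratio-^-<-mono {x * suc v} {x ^ 3} {v * y} {y ^ 3} v (suc v) cross cube
  where
  open ≤-Reasoning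
  x = suc (2 * v)
  y = 2 * v
  cross : x * suc v * y ^ 3 ≤ x ^ 3 * (v * y)
  cross = subst (x * suc v * y ^ 3 ≤_) (sym (solve 1 (λ v →
      (con 1 :+ con 2 :* v) :^ 3 :* (v :* (con 2 :* v))
        := (con 1 :+ con 2 :* v) :* (con 1 :+ v) :* (con 2 :* v) :^ 3 :+ v :* (con 2 :* v) :* (con 1 :+ con 2 :* v))
      refl v)) (m≤m+n _ _)
  cube : (x ^ 3) ^ v < suc v * (y ^ 3) ^ v
  cube = begin-strict
    (x ^ 3) ^ v         ≡⟨ ^-comm x 3 v ⟩
    (x ^ v) ^ 3         ≤⟨ ^-monoˡ-≤ 3 ([1+2n]^n≤2*[2n]^n v) ⟩
    (2 * y ^ v) ^ 3     ≡⟨ ^-distribʳ-* 2 (y ^ v) 3 ⟩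
    8 * (y ^ v) ^ 3     ≡⟨ cong (8 *_) (^-comm y v 3) ⟩
    8 * (y ^ 3) ^ v     <⟨ *-monoˡ-< ((y ^ 3) ^ v) {{m^n≢0 (y ^ 3) v {{m^n≢0 y 3}}}} (s≤s 8≤v) ⟩
    suc v * (y ^ 3) ^ v ∎

ScaledBound-2v : ∀ v → 3 ≤ v → ScaledBound v (2 * v)
ScaledBound-2v 0 ()
ScaledBound-2v 1 (s≤s ())
ScaledBound-2v 2 (s≤s (s≤s ()))
ScaledBound-2v 3 _ = toWitness {a? = ScaledBound? 3 6} tt
ScaledBound-2v 4 _ = toWitness {a? = ScaledBound? 4 8} tt
ScaledBound-2v 5 _ = toWitness {a? = ScaledBound? 5 10} tt
ScaledBound-2v 6 _ = toWitness {a? = ScaledBound? 6 12} tt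
ScaledBound-2v 7 _ = toWitness {a? = ScaledBound? 7 14} tt
ScaledBound-2v v@(suc (suc (suc (suc (suc (suc (suc (suc w)))))))) _ = ScaledBound-2v-large v (m≤m+n 8 w)

lemma3p1 : (v q : ℕ) → 2 ≤ v → IsPrimePower q → 2 * v + 1 ≤ q →
    ¬ (v ≡ 2 × q ≡ 5) → ¬ (v ≡ 2 × q ≡ 7) →
    q ^ v < ((q * v) / suc v) ^ v * suc v
lemma3p1 1 _ (s≤s ()) _ _ _ _
lemma3p1 2 (suc n) _ _ (s≤s 4≤n) ¬[2,5] ¬[2,7] with m≤n⇒∃[o]m+o≡n 4≤n
... | 0 , refl = ⊥-elim (¬[2,5] (refl , refl))
... | 1 , refl = toWitness {a? = 6 ^ 2 <? ((6 * 2) / 3) ^ 2 * 3} tt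
... | 2 , refl = ⊥-elim (¬[2,7] (refl , refl))
... | suc (suc (suc r)) , refl =
  ScaledBound⇒floor-bound 2 n (ScaledBound-mono {2} {7} (m≤m+n 7 r) (toWitness {a? = ScaledBound? 2 7} tt))
lemma3p1 v@(suc (suc (suc _))) (suc n) _ _ 2v+1≤q _ _ =
  ScaledBound⇒floor-bound v n (ScaledBound-mono {v} {2 * v} 2v≤n (ScaledBound-2v v (s≤s (s≤s (s≤s z≤n)))))
  where
  2v≤n : 2 * v ≤ n
  2v≤n = s≤s⁻¹ (subst (_≤ suc n) (+-comm (2 * v) 1) 2v+1≤q)
  instance
    n≢0 : NonZero n
    n≢0 = >-nonZero (<-≤-trans z<s 2v≤n)
lemma3p1 (suc (suc (suc _))) zero _ _ () _ _
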